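{- Let $k \geq 2$ and let $M$ be a strong $k$-chromatic-choosable graph with vertex set $\{v_1,\dots,v_n\}$. Let $a,b\in\mathbb{N}$ and $H = M \square K_{a,b}$, where $K_{a,b}$ has partite sets $\{u_1,\dots,u_a\}$ and $\{w_1,\dots,w_b\}$. Suppose $L$ is a $(k+a-1)$-assignment for $H$ such that there exist $l\in[n]$ and $x,y\in[a]$ with $x \neq y$ and $L(v_l,u_x) \cap L(v_l,u_y) \neq \emptyset$. Then there is a proper $L$-coloring of $H$.
   Context: All graphs are finite, simple and nonempty; $[k]=\{1,\dots,k\}$. A list assignment $L$ assigns to each vertex $v$ a set $L(v)$ of colors; a proper $L$-coloring is a proper coloring $c$ with $c(v)\in L(v)$ for all $v$; the graph is $L$-colorable if one exists. $L$ is a $k$-assignment if $|L(v)|=k$ for all $v$, and is constant if all lists are equal. A graph $G$ is strong $k$-chromatic-choosable if $\chi(G)=k$ and every $(k-1)$-assignment $L$ for which $G$ is not $L$-colorable is constant. The Cartesian product $M \square K$ has vertex set $V(M)\times V(K)$, with $(u,v)$ adjacent to $(u',v')$ iff either $u=u'$ and $vv'\in E(K)$, or $v=v'$ and $uu'\in E(M)$. -}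

module Defs where

open import Data.Nat using (ℕ; _<_; _+_; _∸_; _≤_)
open import Data.Fin using (Fin)
open import Data.Fin.Properties using () renaming (_≟_ to _≟ᶠ_)
open import Data.Sum using (_⊎_; inj₁; inj₂)
open import Data.Product using (_×_; _,_; Σ; ∃; proj₁; proj₂)
open import Data.Empty using (⊥)
open import Data.Unit using (⊤; tt)
open import Data.List using (List; length)
open import Data.List.Membership.Propositional using (_∈_)
open import Data.List.Relation.Unary.Unique.Propositional using (Unique)
open import Relation.Nullary using (¬_; Dec; yes; no)
open import Relation.Binary using (Decidable; DecidableEquality)
open import Data.Sum.Properties using (≡-dec)
open import Relation.Binary.PropositionalEquality using (_≡_; _≢_; refl)

-- A simple graph on vertex type V: symmetric, irreflexive (decidable) adjacency.
-- Finiteness is enforced by using finite vertex types (Fin n, sums/products of Fin).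
record Graph (V : Set) : Set₁ where
  field
    _~_    : V → V → Set
    ~-sym  : ∀ {u v} → u ~ v → v ~ u
    ~-irr  : ∀ {v} → ¬ (v ~ v)
    ~-dec  : Decidable _~_
open Graph public

ListAssignment : Set → Set
ListAssignment V = V → List ℕ

IsKAssignment : {V : Set} → ℕ → ListAssignment V → Set
IsKAssignment k L = ∀ v → Unique (L v) × length (L v) ≡ k

IsConstant : {V : Set} → ListAssignment V → Set
IsConstant L = ∀ u v (c : ℕ) → c ∈ L u → c ∈ L v

IsProper : {V : Set} → Graph V → {C : Set} → (V → C) → Set
IsProper G c = ∀ u v → _~_ G u v → c u ≢ c v

LColorable : {V : Set} → Graph V → ListAssignment V → Set
LColorable {V} G L = Σ (V → ℕ) λ c → (∀ v → c v ∈ L v) × IsProper G c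

Colorable : {V : Set} → Graph V → ℕ → Set
Colorable {V} G m = Σ (V → Fin m) λ c → IsProper G c

ChromaticNumberIs : {V : Set} → Graph V → ℕ → Set
ChromaticNumberIs G k = Colorable G k × (∀ m → m < k → ¬ Colorable G m)

StrongChromaticChoosable : {V : Set} → Graph V → ℕ → Set
StrongChromaticChoosable {V} G k =
  ChromaticNumberIs G k ×
  (∀ (L : ListAssignment V) → IsKAssignment (k ∸ 1) L → ¬ LColorable G L → IsConstant L)

KAdj : (a b : ℕ) → Fin a ⊎ Fin b → Fin a ⊎ Fin b → Set
KAdj a b (inj₁ _) (inj₁ _) = ⊥
KAdj a b (inj₁ _) (inj₂ _) = ⊤
KAdj a b (inj₂ _) (inj₁ _) = ⊤
KAdj a b (inj₂ _) (inj₂ _) = ⊥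

K : (a b : ℕ) → Graph (Fin a ⊎ Fin b)
K a b = record { _~_ = KAdj a b ; ~-sym = sy ; ~-irr = ir ; ~-dec = de }
  where
  sy : ∀ {u v} → KAdj a b u v → KAdj a b v u
  sy {inj₁ _} {inj₂ _} _ = tt
  sy {inj₂ _} {inj₁ _} _ = tt
  ir : ∀ {v} → ¬ KAdj a b v v
  ir {inj₁ _} ()
  ir {inj₂ _} ()
  de : Decidable (KAdj a b)
  de (inj₁ _) (inj₁ _) = no λ ()
  de (inj₁ _) (inj₂ _) = yes tt
  de (inj₂ _) (inj₁ _) = yes tt
  de (inj₂ _) (inj₂ _) = no λ ()

□Adj : {A B : Set} → Graph A → Graph B → A × B → A × B → Set
□Adj M N (u , v) (u' , v') = (u ≡ u' × _~_ N v v') ⊎ (v ≡ v' × _~_ M u u')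

□ : {A B : Set} → Graph A → Graph B →
    DecidableEquality A → DecidableEquality B → Graph (A × B)
□ {A} {B} M N _≟A_ _≟B_ =
  record { _~_ = □Adj M N ; ~-sym = sy ; ~-irr = ir ; ~-dec = de }
  where
  sy : ∀ {p q} → □Adj M N p q → □Adj M N q p
  sy (inj₁ (refl , e)) = inj₁ (refl , ~-sym N e)
  sy (inj₂ (refl , e)) = inj₂ (refl , ~-sym M e)
  ir : ∀ {p} → ¬ □Adj M N p p
  ir (inj₁ (_ , e)) = ~-irr N e
  ir (inj₂ (_ , e)) = ~-irr M e
  de : Decidable (□Adj M N)
  de (u , v) (u' , v') with u ≟A u' | ~-dec N v v' | v ≟B v' | ~-dec M u u'
  ... | yes p | yes q | _ | _ = yes (inj₁ (p , q))
  ... | _ | _ | yes p | yes q = yes (inj₂ (p , q))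
  ... | no p | _ | no r | _ = no λ { (inj₁ (e , _)) → p e ; (inj₂ (e , _)) → r e }
  ... | no p | _ | _ | no s = no λ { (inj₁ (e , _)) → p e ; (inj₂ (_ , f)) → s f }
  ... | _ | no q | no r | _ = no λ { (inj₁ (_ , f)) → q f ; (inj₂ (e , _)) → r e }
  ... | _ | no q | _ | no s = no λ { (inj₁ (_ , f)) → q f ; (inj₂ (_ , f)) → s f }

-- H = M □ K_{a,b}, with vertex (v_l , u_x) = (l , inj₁ x) and (v_l , w_j) = (l , inj₂ j).
_□K[_,_] : {n : ℕ} → Graph (Fin n) → (a b : ℕ) → Graph (Fin n × (Fin a ⊎ Fin b))
M □K[ a , b ] = □ M (K a b) _≟ᶠ_ (≡-dec _≟ᶠ_ _≟ᶠ_)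

{-# OPTIONS --safe #-}
module Submission where

-- Color each copy M × {u_i} from L(·, u_i) minus the common color c: these lists keep
-- k + a − 2 ≥ k colors, so M is colorable from them. Then recolor (v_l, u_i) by c whenever
-- c ∈ L(v_l, u_i); this is proper because c was avoided, and (v_l, u_x), (v_l, u_y) now share c.
-- Each copy M × {w_j} loses at most a colors at every vertex but only a − 1 at v_l, leaving
-- lists of at least k − 1 colors and at least k at v_l, from which M is again colorable.

open import Defs
open import Data.Nat using (ℕ; zero; suc; _≤_; _+_; _∸_; z≤n; s≤s)
open import Data.Nat.Properties
  using (_≟_; ≤-trans; ≤-reflexive; <⇒≤; m≤n⇒m⊓n≡m; +-comm; +-suc; +-monoʳ-≤; ∸-monoˡ-≤;
         m≤n+o⇒m∸n≤o; m+n∸n≡m)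
open import Data.Fin using (Fin; zero; suc; punchIn; punchOut)
open import Data.Fin.Properties using (punchIn-punchOut; all?) renaming (_≟_ to _≟ᶠ_)
open import Data.Sum using (_⊎_; inj₁; inj₂)
open import Data.Product using (_×_; _,_; ∃; proj₁; proj₂)
open import Data.List using (List; []; _∷_; [_]; _++_; length; take; drop; filter; tabulate)
open import Data.List.Properties using (length-take; length-drop; length-++; length-removeAt′; length-tabulate)
open import Data.List.Relation.Unary.Any using (Any; here; there; index; any?; _─_)
import Data.List.Relation.Unary.All as All
open import Data.List.Relation.Unary.AllPairs using (_∷_)
open import Data.List.Relation.Unary.Unique.Propositional using (Unique)
open import Data.List.Relation.Unary.Unique.Propositional.Properties
  using (take⁺; drop⁺; filter⁺; Unique[x∷xs]⇒x∉xs)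
open import Data.List.Relation.Binary.Subset.Propositional using (_⊆_)
open import Data.List.Membership.Propositional using (_∈_; _∉_; find; lose)
open import Data.List.Membership.Propositional.Properties
  using (∈-filter⁺; ∈-filter⁻; ∈-++⁺ˡ; ∈-++⁺ʳ; ∈-tabulate⁺; ∈-tabulate⁻)
open import Data.List.Membership.DecPropositional _≟_ using (_∈?_)
open import Data.Vec.Functional using (Vector; tail; updateAt) renaming (_∷_ to _∷ᶠ_)
open import Data.Vec.Functional.Properties using (updateAt-updates; updateAt-minimal)
open import Data.Empty using (⊥-elim)
open import Function using (_∘_; const)
open import Relation.Nullary using (Dec; yes; no; ¬?)
open import Relation.Nullary.Decidable using (map′; _→-dec_)
open import Relation.Binary.PropositionalEquality using (_≡_; _≢_; _≗_; refl; sym; trans; cong; subst)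

private
  variable
    A : Set
    n : ℕ

take-⊆ : ∀ k {xs : List A} → take k xs ⊆ xs
take-⊆ (suc k) {x ∷ xs} (here refl) = here refl
take-⊆ (suc k) {x ∷ xs} (there z∈) = there (take-⊆ k z∈)

drop-⊆ : ∀ k {xs : List A} → drop k xs ⊆ xs
drop-⊆ zero z∈ = z∈
drop-⊆ (suc k) {x ∷ xs} z∈ = there (drop-⊆ k z∈)

∈-─ : ∀ {x z : A} {ys} (x∈ys : x ∈ ys) → z ∈ ys → z ≢ x → z ∈ (ys ─ x∈ys)
∈-─ (here refl) (here refl) z≢x = ⊥-elim (z≢x refl)
∈-─ (here refl) (there z∈)  _   = z∈
∈-─ (there _)   (here refl) _   = here refl
∈-─ (there x∈)  (there z∈)  z≢x = there (∈-─ x∈ z∈ z≢x)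

Unique-⊆⇒length≤ : ∀ {xs ys : List A} → Unique xs → xs ⊆ ys → length xs ≤ length ys
Unique-⊆⇒length≤ {xs = []} _ _ = z≤n
Unique-⊆⇒length≤ {xs = x ∷ xs} {ys} (x≢xs ∷ uniq) x∷xs⊆ys =
  subst (suc (length xs) ≤_) (sym (length-removeAt′ ys (index x∈ys)))
    (s≤s (Unique-⊆⇒length≤ uniq xs⊆ys─x))
  where
  x∈ys : x ∈ ys
  x∈ys = x∷xs⊆ys (here refl)
  xs⊆ys─x : xs ⊆ (ys ─ x∈ys)
  xs⊆ys─x z∈xs = ∈-─ x∈ys (x∷xs⊆ys (there z∈xs)) (All.lookup x≢xs z∈xs ∘ sym)

infixl 6 _∖_
_∖_ : List ℕ → List ℕ → List ℕ
xs ∖ ds = filter (λ z → ¬? (z ∈? ds)) xs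

∈-∖⁻ : ∀ {z} xs ds → z ∈ xs ∖ ds → z ∈ xs × z ∉ ds
∈-∖⁻ xs ds = ∈-filter⁻ (λ z → ¬? (z ∈? ds))

∖-⊆ : ∀ xs ds → xs ∖ ds ⊆ xs
∖-⊆ xs ds = proj₁ ∘ ∈-∖⁻ xs ds

Unique-∖ : ∀ {xs} ds → Unique xs → Unique (xs ∖ ds)
Unique-∖ ds = filter⁺ (λ z → ¬? (z ∈? ds))

length-∖ : ∀ {xs ds ds′} → Unique xs → ds ⊆ ds′ → length xs ∸ length ds′ ≤ length (xs ∖ ds)
length-∖ {xs} {ds} {ds′} uniq ds⊆ds′ =
  m≤n+o⇒m∸n≤o (length xs) (length ds′)
    (subst (length xs ≤_) (trans (length-++ (xs ∖ ds)) (+-comm (length (xs ∖ ds)) (length ds′)))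
      (Unique-⊆⇒length≤ uniq xs⊆xs∖ds++ds′))
  where
  xs⊆xs∖ds++ds′ : xs ⊆ xs ∖ ds ++ ds′
  xs⊆xs∖ds++ds′ {z} z∈xs with z ∈? ds
  ... | yes z∈ds = ∈-++⁺ʳ (xs ∖ ds) (ds⊆ds′ z∈ds)
  ... | no z∉ds = ∈-++⁺ˡ (∈-filter⁺ (λ z → ¬? (z ∈? ds)) z∈xs z∉ds)

tabulate-⊆-punchIn : ∀ (f : Fin (suc n) → A) {i j} → i ≢ j → f i ≡ f j →
                     tabulate f ⊆ tabulate (f ∘ punchIn j)
tabulate-⊆-punchIn f {i} {j} i≢j fi≡fj z∈ with ∈-tabulate⁻ {f = f} z∈
... | t , refl = covered t
  where
  hit : ∀ {t} → j ≢ t → f t ∈ tabulate (f ∘ punchIn j)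
  hit j≢t = subst (λ s → f s ∈ _) (punchIn-punchOut j≢t) (∈-tabulate⁺ (punchOut j≢t))
  covered : ∀ t → f t ∈ tabulate (f ∘ punchIn j)
  covered t with j ≟ᶠ t
  ... | yes refl = subst (_∈ tabulate (f ∘ punchIn j)) fi≡fj (hit (i≢j ∘ sym))
  ... | no j≢t = hit j≢t

updateAt-pointwise : ∀ {P : Fin n → A → Set} (xs : Vector A n) i {f : A → A} →
                     P i (f (xs i)) → (∀ j → j ≢ i → P j (xs j)) → ∀ j → P j (updateAt xs i f j)
updateAt-pointwise {P = P} xs i Pi Pj j with j ≟ᶠ i
... | yes refl = subst (P i) (sym (updateAt-updates i xs)) Pi
... | no j≢i = subst (P j) (sym (updateAt-minimal j i xs j≢i)) (Pj j j≢i)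

Choice : (Fin n → List A) → ((Fin n → A) → Set) → Set
Choice S Q = ∃ λ c → (∀ v → c v ∈ S v) × Q c

choice? : ∀ (S : Fin n → List A) {Q : (Fin n → A) → Set} → (∀ c → Dec (Q c)) →
          (∀ {c c′} → c ≗ c′ → Q c → Q c′) → Dec (Choice S Q)
choice? {n = zero} S Q? resp with Q? (λ ())
... | yes q = yes ((λ ()) , (λ ()) , q)
... | no ¬q = no λ (_ , _ , q) → ¬q (resp (λ ()) q)
choice? {n = suc n} {A = A} S {Q} Q? resp =
  map′ extend restrict (any? (λ x → choice? (tail S) (Q? ∘ (x ∷ᶠ_)) (resp ∘ cons-cong)) (S zero))
  where
  cons-cong : ∀ {x} {c c′ : Fin n → A} → c ≗ c′ → (x ∷ᶠ c) ≗ (x ∷ᶠ c′)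
  cons-cong c≗c′ zero = refl
  cons-cong c≗c′ (suc v) = c≗c′ v
  extend : Any (λ x → Choice (tail S) (Q ∘ (x ∷ᶠ_))) (S zero) → Choice S Q
  extend any with x , x∈ , c , c∈ , q ← find any =
    (x ∷ᶠ c) , (λ { zero → x∈ ; (suc v) → c∈ v }) , q
  restrict : Choice S Q → Any (λ x → Choice (tail S) (Q ∘ (x ∷ᶠ_))) (S zero)
  restrict (c , c∈ , q) =
    lose (c∈ zero) (tail c , c∈ ∘ suc , resp (λ { zero → refl ; (suc v) → refl }) q)

LColorable? : (M : Graph (Fin n)) (L : ListAssignment (Fin n)) → Dec (LColorable M L)
LColorable? M L = choice? L proper? λ c≗c′ proper u v u~v c′u≡c′v →
  proper u v u~v (trans (c≗c′ u) (trans c′u≡c′v (sym (c≗c′ v))))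
  where
  proper? : ∀ c → Dec (IsProper M c)
  proper? c = all? λ u → all? λ v → ~-dec M u v →-dec ¬? (c u ≟ c v)

LColorable-mono : ∀ {M : Graph (Fin n)} {S T : ListAssignment (Fin n)} →
                  (∀ v → S v ⊆ T v) → LColorable M S → LColorable M T
LColorable-mono S⊆T (c , c∈ , proper) = c , (λ v → S⊆T v (c∈ v)) , proper

updateAt-proper : ∀ {C : Set} (M : Graph (Fin n)) {c : Fin n → C} {d} v₀ →
                  IsProper M c → (∀ v → c v ≢ d) →
                  IsProper M (updateAt c v₀ (const d))
updateAt-proper M {c} {d} v₀ proper avoids-d u v u~v with u ≟ᶠ v₀ | v ≟ᶠ v₀
... | yes refl | yes refl = ⊥-elim (~-irr M u~v)
... | yes refl | no v≢v₀
  rewrite updateAt-updates v₀ {const d} c | updateAt-minimal v v₀ {const d} c v≢v₀ = avoids-d v ∘ sym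
... | no u≢v₀ | yes refl
  rewrite updateAt-minimal u v₀ {const d} c u≢v₀ | updateAt-updates v₀ {const d} c = avoids-d u
... | no u≢v₀ | no v≢v₀
  rewrite updateAt-minimal u v₀ {const d} c u≢v₀ | updateAt-minimal v v₀ {const d} c v≢v₀ = proper u v u~v

another-vertex : ∀ {m} {M : Graph (Fin n)} → ChromaticNumberIs M (2 + m) → (v : Fin n) → ∃ λ w → w ≢ v
another-vertex {n = 1} {M = M} (_ , fewer-colors-fail) zero =
  ⊥-elim (fewer-colors-fail 1 (s≤s (s≤s z≤n)) ((λ _ → zero) , λ { zero zero e → ⊥-elim (~-irr M e) }))
another-vertex {n = suc (suc n)} _ zero = suc zero , λ ()
another-vertex {n = suc (suc n)} _ (suc v) = zero , λ ()

prefixes-IsKAssignment : ∀ {k} {T : ListAssignment (Fin n)} → (∀ v → Unique (T v)) →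
                         (∀ v → k ≤ length (T v)) → IsKAssignment k (λ v → take k (T v))
prefixes-IsKAssignment {k = k} {T} uniq long v =
  take⁺ k (uniq v) , trans (length-take k (T v)) (m≤n⇒m⊓n≡m (long v))

head-∈-take-∉-drop : ∀ k (xs : List A) → Unique xs → 1 ≤ length xs →
                     ∃ λ t → t ∈ take (suc k) xs × t ∉ drop 1 xs
head-∈-take-∉-drop k (x ∷ xs) uniq _ = x , here refl , Unique[x∷xs]⇒x∉xs uniq

-- The (k − 1)-prefixes of T and of T with the first color t of T v₀ removed agree at any
-- w ≢ v₀ (one exists as χ(M) ≥ 2). If neither admits a coloring, both are constant, so t lies
-- in the common prefix at w and therefore in T v₀ after t itself.
strongChoosable⇒LColorable :
  ∀ {m} {M : Graph (Fin n)} → StrongChromaticChoosable M (2 + m) →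
  (T : ListAssignment (Fin n)) → (∀ v → Unique (T v)) → (∀ v → suc m ≤ length (T v)) →
  (v₀ : Fin n) → 2 + m ≤ length (T v₀) → LColorable M T
strongChoosable⇒LColorable {n = n} {m = m} {M} (χM , strong) T uniq long v₀ long₀ =
  conclude (LColorable? M (prefixes T)) (LColorable? M (prefixes T′))
  where
  prefixes : ListAssignment (Fin n) → ListAssignment (Fin n)
  prefixes S v = take (suc m) (S v)

  T′ : ListAssignment (Fin n)
  T′ = updateAt T v₀ (drop 1)

  T′⊆T : ∀ v → T′ v ⊆ T v
  T′⊆T = updateAt-pointwise {P = λ v S → S ⊆ T v} T v₀ (drop-⊆ 1) (λ _ _ z∈ → z∈)

  T′-unique : ∀ v → Unique (T′ v)
  T′-unique = updateAt-pointwise {P = λ _ → Unique} T v₀ (drop⁺ 1 (uniq v₀)) (λ v _ → uniq v)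

  T′-long : ∀ v → suc m ≤ length (T′ v)
  T′-long = updateAt-pointwise {P = λ _ S → suc m ≤ length S} T v₀
    (subst (suc m ≤_) (sym (length-drop 1 (T v₀))) (∸-monoˡ-≤ 1 long₀)) (λ v _ → long v)

  conclude : Dec (LColorable M (prefixes T)) → Dec (LColorable M (prefixes T′)) → LColorable M T
  conclude (yes col) _ = LColorable-mono {M = M} (λ v → take-⊆ (suc m) {T v}) col
  conclude (no _) (yes col′) = LColorable-mono {M = M} (λ v → T′⊆T v ∘ take-⊆ (suc m) {T′ v}) col′
  conclude (no ¬col) (no ¬col′)
    with w , w≢v₀ ← another-vertex {M = M} χM v₀
       | t , t∈T , t∉T′ ← head-∈-take-∉-drop m (T v₀) (uniq v₀) (≤-trans (s≤s z≤n) long₀)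
    = ⊥-elim (t∉T′ (take-⊆ (suc m) t∈T′v₀))
    where
    constant : IsConstant (prefixes T)
    constant = strong (prefixes T) (prefixes-IsKAssignment uniq long) ¬col
    constant′ : IsConstant (prefixes T′)
    constant′ = strong (prefixes T′) (prefixes-IsKAssignment T′-unique T′-long) ¬col′
    t∈T′w : t ∈ prefixes T′ w
    t∈T′w = subst (λ S → t ∈ take (suc m) S) (sym (updateAt-minimal w v₀ T w≢v₀))
                  (constant v₀ w t t∈T)
    t∈T′v₀ : t ∈ take (suc m) (drop 1 (T v₀))
    t∈T′v₀ = subst (λ S → t ∈ take (suc m) S) (updateAt-updates v₀ T) (constant′ w v₀ t t∈T′w)

copies : ∀ {a b} {C : Set} → (Fin a → Fin n → C) → (Fin b → Fin n → C) →
         Fin n × (Fin a ⊎ Fin b) → C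
copies φ χ (v , inj₁ i) = φ i v
copies φ χ (v , inj₂ j) = χ j v

copies-proper : ∀ {a b} (M : Graph (Fin n)) (φ : Fin a → Fin n → ℕ) (χ : Fin b → Fin n → ℕ) →
                (∀ i → IsProper M (φ i)) → (∀ j → IsProper M (χ j)) → (∀ i j v → φ i v ≢ χ j v) →
                IsProper (M □K[ a , b ]) (copies φ χ)
copies-proper M φ χ φ-proper χ-proper φ≢χ = proper
  where
  proper : IsProper (M □K[ _ , _ ]) (copies φ χ)
  proper (u , inj₁ i) (.u , inj₂ j)  (inj₁ (refl , _)) = φ≢χ i j u
  proper (u , inj₂ j) (.u , inj₁ i)  (inj₁ (refl , _)) = φ≢χ i j u ∘ sym
  proper (u , inj₁ i) (u′ , inj₁ .i) (inj₂ (refl , u~u′)) = φ-proper i u u′ u~u′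
  proper (u , inj₂ j) (u′ , inj₂ .j) (inj₂ (refl , u~u′)) = χ-proper j u u′ u~u′

module _ {m p n b} {M : Graph (Fin n)} (strong : StrongChromaticChoosable M (2 + m))
         (L : ListAssignment (Fin n × (Fin (2 + p) ⊎ Fin b)))
         (L-k : IsKAssignment (suc (m + (2 + p))) L)
         (l : Fin n) {x y : Fin (2 + p)} (x≢y : x ≢ y)
         {c : ℕ} (c∈x : c ∈ L (l , inj₁ x)) (c∈y : c ∈ L (l , inj₁ y)) where

  private
    L∖-long : ∀ q {ds ds′} → ds ⊆ ds′ → suc (m + (2 + p)) ∸ length ds′ ≤ length (L q ∖ ds)
    L∖-long q {ds} {ds′} ds⊆ds′ =
      subst (λ t → t ∸ length ds′ ≤ length (L q ∖ ds)) (proj₂ (L-k q))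
            (length-∖ (proj₁ (L-k q)) ds⊆ds′)

    uList : Fin (2 + p) → ListAssignment (Fin n)
    uList i v = L (v , inj₁ i) ∖ [ c ]

    uList-long : ∀ i v → 2 + m ≤ length (uList i v)
    uList-long i v =
      ≤-trans (≤-trans (≤-reflexive (+-comm 2 m)) (+-monoʳ-≤ m (s≤s (s≤s z≤n))))
              (L∖-long _ (λ z∈ → z∈))

    ψ-coloring : ∀ i → LColorable M (uList i)
    ψ-coloring i = strongChoosable⇒LColorable {M = M} strong (uList i)
      (λ v → Unique-∖ [ c ] (proj₁ (L-k _))) (λ v → <⇒≤ (uList-long i v)) l (uList-long i l)

    ψ : Fin (2 + p) → Fin n → ℕ
    ψ i = proj₁ (ψ-coloring i)

    ψ-∈ : ∀ i v → ψ i v ∈ L (v , inj₁ i)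
    ψ-∈ i v = ∖-⊆ (L (v , inj₁ i)) [ c ] (proj₁ (proj₂ (ψ-coloring i)) v)

    ψ≢c : ∀ i v → ψ i v ≢ c
    ψ≢c i v ψ≡c =
      proj₂ (∈-∖⁻ (L (v , inj₁ i)) [ c ] (proj₁ (proj₂ (ψ-coloring i)) v)) (here ψ≡c)

    φ : Fin (2 + p) → Fin n → ℕ
    φ i with c ∈? L (l , inj₁ i)
    ... | yes _ = updateAt (ψ i) l (const c)
    ... | no _ = ψ i

    φ-proper : ∀ i → IsProper M (φ i)
    φ-proper i with c ∈? L (l , inj₁ i)
    ... | yes _ = updateAt-proper M l (proj₂ (proj₂ (ψ-coloring i))) (ψ≢c i)
    ... | no _ = proj₂ (proj₂ (ψ-coloring i))

    φ-∈ : ∀ i v → φ i v ∈ L (v , inj₁ i)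
    φ-∈ i with c ∈? L (l , inj₁ i)
    ... | yes c∈ = updateAt-pointwise {P = λ v z → z ∈ L (v , inj₁ i)} (ψ i) l c∈ (λ v _ → ψ-∈ i v)
    ... | no _ = ψ-∈ i

    φ-at-l : ∀ {i} → c ∈ L (l , inj₁ i) → φ i l ≡ c
    φ-at-l {i} c∈ with c ∈? L (l , inj₁ i)
    ... | yes _ = updateAt-updates l (ψ i)
    ... | no c∉ = ⊥-elim (c∉ c∈)

    column : Fin n → List ℕ
    column v = tabulate (λ i → φ i v)

    wList : Fin b → ListAssignment (Fin n)
    wList j v = L (v , inj₂ j) ∖ column v

    wList-long : ∀ j v → suc m ≤ length (wList j v)
    wList-long j v = subst (_≤ length (wList j v))
      (trans (cong (suc (m + (2 + p)) ∸_) (length-tabulate (λ i → φ i v))) (m+n∸n≡m (suc m) (2 + p)))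
      (L∖-long _ (λ z∈ → z∈))

    column-l-short : column l ⊆ tabulate ((λ i → φ i l) ∘ punchIn y)
    column-l-short = tabulate-⊆-punchIn (λ i → φ i l) x≢y (trans (φ-at-l c∈x) (sym (φ-at-l c∈y)))

    wList-long-at-l : ∀ j → 2 + m ≤ length (wList j l)
    wList-long-at-l j = subst (_≤ length (wList j l))
      (trans (cong (suc (m + (2 + p)) ∸_) (length-tabulate ((λ i → φ i l) ∘ punchIn y)))
        (trans (cong (_∸ p) (trans (+-suc m (suc p)) (cong suc (+-suc m p)))) (m+n∸n≡m (2 + m) p)))
      (L∖-long _ column-l-short)

    χ-coloring : ∀ j → LColorable M (wList j)
    χ-coloring j = strongChoosable⇒LColorable {M = M} strong (wList j)
      (λ v → Unique-∖ (column v) (proj₁ (L-k _))) (wList-long j) l (wList-long-at-l j)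

    χ : Fin b → Fin n → ℕ
    χ j = proj₁ (χ-coloring j)

    φ≢χ : ∀ i j v → φ i v ≢ χ j v
    φ≢χ i j v φ≡χ = proj₂ (∈-∖⁻ (L (v , inj₂ j)) (column v) (proj₁ (proj₂ (χ-coloring j)) v))
      (subst (_∈ column v) φ≡χ (∈-tabulate⁺ {f = λ i → φ i v} i))

  LColorable-□K : LColorable (M □K[ 2 + p , b ]) L
  LColorable-□K =
    copies φ χ , copies-∈ , copies-proper M φ χ φ-proper (proj₂ ∘ proj₂ ∘ χ-coloring) φ≢χ
    where
    copies-∈ : ∀ q → copies φ χ q ∈ L q
    copies-∈ (v , inj₁ i) = φ-∈ i v
    copies-∈ (v , inj₂ j) = ∖-⊆ (L (v , inj₂ j)) (column v) (proj₁ (proj₂ (χ-coloring j)) v)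

lemma3p3 : (k : ℕ) → 2 ≤ k → (n : ℕ) → (M : Graph (Fin n)) → StrongChromaticChoosable M k →
    (a b : ℕ) → (L : ListAssignment (Fin n × (Fin a ⊎ Fin b))) → IsKAssignment (k + a ∸ 1) L →
    (l : Fin n) → (x y : Fin a) → x ≢ y →
    ∃ (λ c → c ∈ L (l , inj₁ x) × c ∈ L (l , inj₁ y)) →
    LColorable (M □K[ a , b ]) L
lemma3p3 (suc (suc m)) (s≤s (s≤s _)) _ M strong (suc (suc p)) _ L L-k l _ _ x≢y (_ , c∈x , c∈y) =
  LColorable-□K {M = M} strong L L-k l x≢y c∈x c∈y
lemma3p3 (suc (suc _)) (s≤s (s≤s _)) _ _ _ 1 _ _ _ _ zero zero 0≢0 _ = ⊥-elim (0≢0 refl)
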